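{- Let $q$ be a prime power, $u,v$ non-zero elements of $\mathbb{F}_q$, and write $\mathrm{Rad}(q-1)=k\,p_1\cdots p_s$ with $k$ a divisor and $p_1,\dots,p_s$ distinct primes. Let $\delta_2=1-2\sum_{i=1}^s\frac1{p_i}$. Then $$M\ge\sum_{i=1}^s\Big\{[M_{p_ik,k}-\theta(p_i)M_{k,k}]+[M_{k,p_ik}-\theta(p_i)M_{k,k}]\Big\}+\delta_2M_{k,k}.$$
   Context: For $e\mid q-1$, a non-zero $a\in\mathbb{F}_q$ is $e$-free if $a=b^d$ with $b\in\mathbb{F}_q$ and $d\mid e$ implies $d=1$ ($(q-1)$-free means primitive, i.e. a generator of $\mathbb{F}_q^*$). For divisors $e_1,e_2$ of $q-1$, $M_{e_1,e_2}$ is the number of non-zero $a\in\mathbb{F}_q$ such that $a$ is $e_1$-free and $ua+va^{ -1}$ is $e_2$-free; $M=M_{q-1,q-1}$ is the number of primitive $a$ with $ua+va^{ -1}$ primitive. $\mathrm{Rad}(m)$ is the product of the distinct primes dividing $m$; $\theta(m)=\phi(m)/m$. -}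

module Defs where

open import Data.Nat as ℕ using (ℕ; zero; suc; _∸_; _≟_)
open import Data.Nat.Divisibility using (_∣_; _∣?_)
open import Data.Nat.Primality using (prime?)
open import Data.Nat.Coprimality using (coprime?)
open import Data.Integer using (+_)
open import Data.Rational using (ℚ; _/_; 0ℚ; 1ℚ) renaming (_+_ to _+ℚ_; _-_ to _-ℚ_; _*_ to _*ℚ_)
open import Data.List using (List; []; _∷_; length; filter; filterᵇ; upTo)
open import Data.Nat.ListAction using (product)
open import Data.Bool.ListAction using (any)
open import Data.List.Membership.Propositional using (_∈_)
open import Data.List.Relation.Unary.Unique.Propositional using (Unique)
open import Data.Bool using (Bool; true; false; not; _∧_)
open import Relation.Nullary using (¬_; does)
open import Relation.Nullary.Decidable using (_×-dec_)
open import Relation.Binary.Definitions using (DecidableEquality)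
open import Relation.Binary.PropositionalEquality using (_≡_; _≢_)
open import Algebra.Structures using (IsCommutativeRing)

record FiniteField : Set₁ where
  field
    Carrier : Set
    _+_ _*_ : Carrier → Carrier → Carrier
    -_ : Carrier → Carrier
    0# 1# : Carrier
    isCommutativeRing : IsCommutativeRing _≡_ _+_ _*_ -_ 0# 1#
    0≢1 : 0# ≢ 1#
    _⁻¹ : Carrier → Carrier
    ⁻¹-inverse : ∀ x → x ≢ 0# → x * (x ⁻¹) ≡ 1#
    _≟F_ : DecidableEquality Carrier
    elems : List Carrier
    elems-complete : ∀ x → x ∈ elems
    elems-unique : Unique elems

  q : ℕ
  q = length elems

  _^_ : Carrier → ℕ → Carrier
  b ^ zero = 1#
  b ^ suc n = b * (b ^ n)

  -- a is e-free: a ≠ 0 and there are no b ∈ F_q and d ∣ e with d ≠ 1 and a = b^d.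
  -- (decided by enumeration; d ∣ e with e ≠ 0 forces d ≤ e)
  isFree : ℕ → Carrier → Bool
  isFree e a =
    not (does (a ≟F 0#)) ∧
    not (any (λ d → does ((¬? (d ≟ 1)) ×-dec (d ∣? e)) ∧
                    any (λ b → does (a ≟F (b ^ d))) elems)
             (upTo (suc e)))
    where open import Relation.Nullary.Decidable using (¬?)

  Mcount : Carrier → Carrier → ℕ → ℕ → ℕ
  Mcount u v e₁ e₂ =
    length (filterᵇ (λ a → not (does (a ≟F 0#)) ∧ isFree e₁ a
                              ∧ isFree e₂ ((u * a) + (v * (a ⁻¹))))
                    elems)

Rad : ℕ → ℕ
Rad m = product (filter (λ p → prime? p ×-dec p ∣? m) (upTo (suc m)))

φ : ℕ → ℕ
φ m = length (filter (λ i → coprime? i m) (upTo (suc m)) )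

-- θ(m) = φ(m)/m  (θ 0 is a junk value, never used)
θ : ℕ → ℚ
θ zero = 0ℚ
θ (suc n) = + φ (suc n) / suc n

⟦_⟧ : ℕ → ℚ
⟦ n ⟧ = + n / 1

inv : ℕ → ℚ
inv zero = 0ℚ
inv (suc n) = + 1 / suc n

Σℚ : List ℕ → (ℕ → ℚ) → ℚ
Σℚ [] f = 0ℚ
Σℚ (p ∷ ps) f = f p +ℚ Σℚ ps f

δ₂ : List ℕ → ℚ
δ₂ ps = 1ℚ -ℚ (⟦ 2 ⟧ *ℚ Σℚ ps inv)

-- For a ≠ 0 let S(a) say that a and ua + va⁻¹ are both k-free, and let A_p(a), B_p(a) say the
-- same with the exponent k of a, respectively of ua + va⁻¹, replaced by pk. Each A_p and B_p
-- implies S, and since every prime divisor of q − 1 divides k or some p_i, S together with all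
-- A_p and B_p implies that a and ua + va⁻¹ are primitive. Hence, pointwise in a,
--   Σ_p (A_p + B_p) + S ≤ [a counted by M] + 2s·S :
-- if S fails both sides vanish, and otherwise either all 2s conditions hold or one of them fails.
-- Summing over a gives Σ_p (M_{pk,k} + M_{k,pk}) + M_{k,k} ≤ M + 2s·M_{k,k}, which is the claim
-- after substituting θ(p) = 1 − 1/p.

module Submission where

open import Defs

module Primes where

  open import Data.Nat using (s≤s; _*_; NonZero; ≢-nonZero; ≢-nonZero⁻¹; nonTrivial⇒≢1)
  open import Data.Nat.Properties using (m*n≢0)
  open import Data.Nat.Divisibility using (_∣_; _∣?_; ∣⇒≤; 0∣⇒≡0)
  open import Data.Nat.Primality using (Prime; prime?; prime⇒nonTrivial; prime⇒nonZero)
  open import Data.Nat.Primality.Factorisation using (factorise)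
  open import Data.Nat.ListAction.Properties using (∈⇒∣product)
  open import Data.List using ([]; _∷_)
  open import Data.List.Membership.Propositional.Properties using (∈-upTo⁺; ∈-filter⁺)
  open import Data.List.Relation.Unary.All using (_∷_)
  open import Data.List.Relation.Unary.Any using (here)
  open import Data.Product using (∃-syntax; _×_; _,_)
  open import Relation.Nullary using (contradiction)
  open import Relation.Nullary.Decidable using (_×-dec_)
  open import Relation.Binary.PropositionalEquality

  prime⇒≢1 : ∀ {p} → Prime p → p ≢ 1
  prime⇒≢1 {p} p-prime = nonTrivial⇒≢1 {p} {{prime⇒nonTrivial p-prime}}

  ∃-prime-∣ : ∀ {d} → d ≢ 0 → d ≢ 1 → ∃[ r ] Prime r × r ∣ d
  ∃-prime-∣ {d} d≢0 d≢1 with factorise d {{≢-nonZero d≢0}}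
  ... | record { factors = [] ; isFactorisation = d≡1 } = contradiction d≡1 d≢1
  ... | record { factors = r ∷ rs ; isFactorisation = d≡Πrs ; factorsPrime = r-prime ∷ _ } =
    r , r-prime , subst (r ∣_) (sym d≡Πrs) (∈⇒∣product {ns = r ∷ rs} (here refl))

  ∣⇒nonZero : ∀ {m n} .{{_ : NonZero n}} → m ∣ n → NonZero m
  ∣⇒nonZero {m} {n} m∣n = ≢-nonZero λ m≡0 → ≢-nonZero⁻¹ n (0∣⇒≡0 (subst (_∣ n) m≡0 m∣n))

  prime*-nonZero : ∀ {p k} → Prime p → .{{_ : NonZero k}} → NonZero (p * k)
  prime*-nonZero {p} {k} p-prime = m*n≢0 p k {{prime⇒nonZero p-prime}}

  prime∣⇒∣Rad : ∀ {m r} .{{_ : NonZero m}} → Prime r → r ∣ m → r ∣ Rad m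
  prime∣⇒∣Rad {m} r-prime r∣m =
    ∈⇒∣product (∈-filter⁺ (λ p → prime? p ×-dec p ∣? m) (∈-upTo⁺ (s≤s (∣⇒≤ r∣m))) (r-prime , r∣m))

module Totient where

  open import Data.Nat using (suc; s≤s)
  open import Data.Nat.Properties using (+-identityʳ)
  open import Data.Nat.Primality using (Prime)
  open import Data.Nat.Coprimality as Coprime using (Coprime; coprime?; prime⇒coprime; 0-coprimeTo-m⇒m≡1)
  open import Data.Nat.Divisibility using (∣-refl)
  open import Data.List using ([]; _∷_; _++_; length; filter; applyUpTo)
  open import Data.List.Properties using (filter-all; filter-reject; filter-++; applyUpTo-∷ʳ; length-++; length-applyUpTo)
  open import Data.List.Membership.Propositional.Properties using (∈-applyUpTo⁻)
  open import Data.List.Relation.Unary.All as All using (All)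
  open import Data.Product using (_,_)
  open import Relation.Binary.PropositionalEquality
  open import Function using (_∘_; case_of_)
  open Primes using (prime⇒≢1)

  φ-prime : ∀ n → Prime (suc n) → φ (suc n) ≡ n
  φ-prime n p-prime = begin
    length (filter coprime-p? (0 ∷ applyUpTo suc (suc n)))
      ≡⟨ cong length (filter-reject coprime-p? (prime⇒≢1 p-prime ∘ 0-coprimeTo-m⇒m≡1)) ⟩
    length (filter coprime-p? (applyUpTo suc (suc n)))
      ≡⟨ cong (length ∘ filter coprime-p?) (applyUpTo-∷ʳ suc n) ⟨
    length (filter coprime-p? (applyUpTo suc n ++ suc n ∷ []))
      ≡⟨ cong length (filter-++ coprime-p? (applyUpTo suc n) (suc n ∷ [])) ⟩
    length (filter coprime-p? (applyUpTo suc n) ++ filter coprime-p? (suc n ∷ []))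
      ≡⟨ cong₂ (λ xs ys → length (xs ++ ys)) (filter-all coprime-p? below-p-coprime)
               (filter-reject coprime-p? {xs = []} (λ p-coprime → prime⇒≢1 p-prime (p-coprime (∣-refl , ∣-refl)))) ⟩
    length (applyUpTo suc n ++ [])
      ≡⟨ trans (length-++ (applyUpTo suc n)) (+-identityʳ _) ⟩
    length (applyUpTo suc n)
      ≡⟨ length-applyUpTo suc n ⟩
    n ∎
    where
    open ≡-Reasoning
    coprime-p? = λ i → coprime? i (suc n)
    below-p-coprime : All (λ i → Coprime i (suc n)) (applyUpTo suc n)
    below-p-coprime = All.tabulate λ i∈ → case ∈-applyUpTo⁻ suc i∈ of λ where
      (j , j<n , refl) → Coprime.sym (prime⇒coprime p-prime (s≤s j<n))

module Rationals where

  open import Data.Nat as ℕ using (ℕ; suc)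
  open import Data.Integer as ℤ using (+_)
  import Data.Integer.Properties as ℤ
  open import Data.Integer.Tactic.RingSolver using (solve-∀)
  open import Data.Rational using (ℚ; _≤_; _+_; _-_; -_; 0ℚ; 1ℚ; toℚᵘ; fromℚᵘ) renaming (_*_ to _*ℚ_)
  open import Data.Rational.Properties
    using (toℚᵘ-fromℚᵘ; toℚᵘ-injective; toℚᵘ-homo-+; toℚᵘ-homo-*; toℚᵘ-cancel-≤; fromℚᵘ-cong; +-monoˡ-≤; module ≤-Reasoning)
  open import Data.Rational.Solver using (module +-*-Solver)
  open import Data.Rational.Unnormalised as ℚᵘ
    using (ℚᵘ; mkℚᵘ; _≃_; *≡*; *≤*) renaming (_≤_ to _≤ᵘ_; _+_ to _+ᵘ_; _*_ to _*ᵘ_)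
  import Data.Rational.Unnormalised.Properties as ℚᵘ
  open import Data.Nat.Primality using (Prime)
  open import Data.Nat.ListAction using (sum)
  open import Data.List using ([]; _∷_; length; map)
  open import Data.List.Relation.Unary.All using (All; []; _∷_)
  open import Relation.Binary.PropositionalEquality

  fromℚᵘ-homo-+ : ∀ p q → fromℚᵘ (p +ᵘ q) ≡ fromℚᵘ p + fromℚᵘ q
  fromℚᵘ-homo-+ p q = toℚᵘ-injective (begin
    toℚᵘ (fromℚᵘ (p +ᵘ q))                ≈⟨ toℚᵘ-fromℚᵘ (p +ᵘ q) ⟩
    p +ᵘ q                                ≈⟨ ℚᵘ.+-cong (toℚᵘ-fromℚᵘ p) (toℚᵘ-fromℚᵘ q) ⟨
    toℚᵘ (fromℚᵘ p) +ᵘ toℚᵘ (fromℚᵘ q)    ≈⟨ toℚᵘ-homo-+ (fromℚᵘ p) (fromℚᵘ q) ⟨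
    toℚᵘ (fromℚᵘ p + fromℚᵘ q)            ∎)
    where open ℚᵘ.≃-Reasoning

  fromℚᵘ-homo-* : ∀ p q → fromℚᵘ (p *ᵘ q) ≡ fromℚᵘ p *ℚ fromℚᵘ q
  fromℚᵘ-homo-* p q = toℚᵘ-injective (begin
    toℚᵘ (fromℚᵘ (p *ᵘ q))                ≈⟨ toℚᵘ-fromℚᵘ (p *ᵘ q) ⟩
    p *ᵘ q                                ≈⟨ ℚᵘ.*-cong (toℚᵘ-fromℚᵘ p) (toℚᵘ-fromℚᵘ q) ⟨
    toℚᵘ (fromℚᵘ p) *ᵘ toℚᵘ (fromℚᵘ q)    ≈⟨ toℚᵘ-homo-* (fromℚᵘ p) (fromℚᵘ q) ⟨
    toℚᵘ (fromℚᵘ p *ℚ fromℚᵘ q)           ∎)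
    where open ℚᵘ.≃-Reasoning

  fromℚᵘ-mono-≤ : ∀ {p q} → p ≤ᵘ q → fromℚᵘ p ≤ fromℚᵘ q
  fromℚᵘ-mono-≤ {p} {q} p≤q = toℚᵘ-cancel-≤
    (ℚᵘ.≤-respʳ-≃ (ℚᵘ.≃-sym (toℚᵘ-fromℚᵘ q)) (ℚᵘ.≤-respˡ-≃ (ℚᵘ.≃-sym (toℚᵘ-fromℚᵘ p)) p≤q))

  -- ⟦ n ⟧ is definitionally fromℚᵘ ⟦ n ⟧ᵘ, which lets the normalising ⟦_⟧ be handled through ℚᵘ.
  ⟦_⟧ᵘ : ℕ → ℚᵘ
  ⟦ n ⟧ᵘ = mkℚᵘ (+ n) 0

  ⟦⟧ᵘ-homo-+ : ∀ m n → ⟦ m ℕ.+ n ⟧ᵘ ≃ ⟦ m ⟧ᵘ +ᵘ ⟦ n ⟧ᵘ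
  ⟦⟧ᵘ-homo-+ m n = *≡* (cong (ℤ._* + 1) (sym (cong₂ ℤ._+_ (ℤ.*-identityʳ (+ m)) (ℤ.*-identityʳ (+ n)))))

  ⟦⟧ᵘ-homo-* : ∀ m n → ⟦ m ℕ.* n ⟧ᵘ ≃ ⟦ m ⟧ᵘ *ᵘ ⟦ n ⟧ᵘ
  ⟦⟧ᵘ-homo-* m n = *≡* (cong (ℤ._* + 1) (ℤ.pos-* m n))

  ⟦⟧-homo-+ : ∀ m n → ⟦ m ℕ.+ n ⟧ ≡ ⟦ m ⟧ + ⟦ n ⟧
  ⟦⟧-homo-+ m n = trans (fromℚᵘ-cong (⟦⟧ᵘ-homo-+ m n)) (fromℚᵘ-homo-+ ⟦ m ⟧ᵘ ⟦ n ⟧ᵘ)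

  ⟦⟧-homo-* : ∀ m n → ⟦ m ℕ.* n ⟧ ≡ ⟦ m ⟧ *ℚ ⟦ n ⟧
  ⟦⟧-homo-* m n = trans (fromℚᵘ-cong (⟦⟧ᵘ-homo-* m n)) (fromℚᵘ-homo-* ⟦ m ⟧ᵘ ⟦ n ⟧ᵘ)

  ⟦⟧-mono-≤ : ∀ {m n} → m ℕ.≤ n → ⟦ m ⟧ ≤ ⟦ n ⟧
  ⟦⟧-mono-≤ {m} {n} m≤n = fromℚᵘ-mono-≤ {⟦ m ⟧ᵘ} {⟦ n ⟧ᵘ} (*≤* (ℤ.*-monoʳ-≤-nonNeg (+ 1) (ℤ.+≤+ m≤n)))

  ⟦⟧-homo-sum : ∀ (f : ℕ → ℕ) ps → ⟦ sum (map f ps) ⟧ ≡ Σℚ ps (λ p → ⟦ f p ⟧)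
  ⟦⟧-homo-sum f [] = refl
  ⟦⟧-homo-sum f (p ∷ ps) = trans (⟦⟧-homo-+ (f p) _) (cong (_+_ ⟦ f p ⟧) (⟦⟧-homo-sum f ps))

  θ-prime : ∀ {p} → Prime p → θ p ≡ 1ℚ - inv p
  θ-prime {suc n} p-prime = begin
    θ (suc n)                                ≡⟨ solve 2 (λ t i → t := (t :+ i) :- i) refl (θ (suc n)) (inv (suc n)) ⟩
    (θ (suc n) + inv (suc n)) - inv (suc n)  ≡⟨ cong (_- inv (suc n)) θ+inv≡1 ⟩
    1ℚ - inv (suc n)                         ∎
    where
    open ≡-Reasoning
    open +-*-Solver using (solve; _:=_; _:+_; _:-_)
    n²-identity : ∀ x → (x ℤ.* (+ 1 ℤ.+ x) ℤ.+ + 1 ℤ.* (+ 1 ℤ.+ x)) ℤ.* + 1 ≡ + 1 ℤ.* ((+ 1 ℤ.+ x) ℤ.* (+ 1 ℤ.+ x))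
    n²-identity = solve-∀
    n/p+1/p≃1 : mkℚᵘ (+ n) n +ᵘ mkℚᵘ (+ 1) n ≃ ℚᵘ.1ℚᵘ
    n/p+1/p≃1 = *≡* (trans (n²-identity (+ n)) (cong (+ 1 ℤ.*_) (sym (ℤ.pos-* (suc n) (suc n)))))
    θ+inv≡1 : θ (suc n) + inv (suc n) ≡ 1ℚ
    θ+inv≡1 rewrite Totient.φ-prime n p-prime =
      trans (sym (fromℚᵘ-homo-+ (mkℚᵘ (+ n) n) (mkℚᵘ (+ 1) n)))
            (fromℚᵘ-cong n/p+1/p≃1)

  Σℚ-θ-weights : ∀ (a b : ℕ → ℚ) s ps → All Prime ps →
    Σℚ ps (λ p → (a p - θ p *ℚ s) + (b p - θ p *ℚ s))
      ≡ (Σℚ ps a + Σℚ ps b) - (⟦ length ps ⟧ + ⟦ length ps ⟧) *ℚ s + ⟦ 2 ⟧ *ℚ Σℚ ps inv *ℚ s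
  Σℚ-θ-weights a b s [] [] =
    solve 1 (λ s → con 0ℚ := ((con 0ℚ :+ con 0ℚ) :- (con ⟦ 0 ⟧ :+ con ⟦ 0 ⟧) :* s) :+ (con ⟦ 2 ⟧ :* con 0ℚ) :* s) refl s
    where open +-*-Solver using (solve; _:=_; _:+_; _:-_; _:*_; con)
  Σℚ-θ-weights a b s (p ∷ ps) (p-prime ∷ ps-prime) = begin
    ((a p - θ p *ℚ s) + (b p - θ p *ℚ s)) + Σℚ ps (λ p → (a p - θ p *ℚ s) + (b p - θ p *ℚ s))
      ≡⟨ cong₂ _+_ (cong (λ t → (a p - t *ℚ s) + (b p - t *ℚ s)) (θ-prime p-prime)) (Σℚ-θ-weights a b s ps ps-prime) ⟩
    ((a p - (1ℚ - inv p) *ℚ s) + (b p - (1ℚ - inv p) *ℚ s)) + ((A + B) - (N + N) *ℚ s + ⟦ 2 ⟧ *ℚ σ *ℚ s)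
      ≡⟨ solve 8 (λ x y i A B N σ s →
                  ((x :- (con 1ℚ :- i) :* s) :+ (y :- (con 1ℚ :- i) :* s)) :+ (((A :+ B) :- (N :+ N) :* s) :+ (con ⟦ 2 ⟧ :* σ) :* s)
               := (((x :+ A) :+ (y :+ B)) :- ((con ⟦ 1 ⟧ :+ N) :+ (con ⟦ 1 ⟧ :+ N)) :* s) :+ (con ⟦ 2 ⟧ :* (i :+ σ)) :* s)
             refl (a p) (b p) (inv p) A B N σ s ⟩
    ((a p + A) + (b p + B)) - ((⟦ 1 ⟧ + N) + (⟦ 1 ⟧ + N)) *ℚ s + ⟦ 2 ⟧ *ℚ (inv p + σ) *ℚ s
      ≡⟨ cong (λ N′ → ((a p + A) + (b p + B)) - (N′ + N′) *ℚ s + ⟦ 2 ⟧ *ℚ (inv p + σ) *ℚ s) (⟦⟧-homo-+ 1 (length ps)) ⟨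
    ((a p + A) + (b p + B)) - (⟦ 1 ℕ.+ length ps ⟧ + ⟦ 1 ℕ.+ length ps ⟧) *ℚ s + ⟦ 2 ⟧ *ℚ (inv p + σ) *ℚ s ∎
    where
    open ≡-Reasoning
    open +-*-Solver using (solve; _:=_; _:+_; _:-_; _:*_; con)
    A = Σℚ ps a
    B = Σℚ ps b
    N = ⟦ length ps ⟧
    σ = Σℚ ps inv

  m≤n+o⇒⟦m⟧-⟦o⟧≤⟦n⟧ : ∀ {m n o} → m ℕ.≤ n ℕ.+ o → ⟦ m ⟧ - ⟦ o ⟧ ≤ ⟦ n ⟧
  m≤n+o⇒⟦m⟧-⟦o⟧≤⟦n⟧ {m} {n} {o} m≤n+o = begin
    ⟦ m ⟧ - ⟦ o ⟧            ≤⟨ +-monoˡ-≤ (- ⟦ o ⟧) (⟦⟧-mono-≤ m≤n+o) ⟩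
    ⟦ n ℕ.+ o ⟧ - ⟦ o ⟧      ≡⟨ cong (_- ⟦ o ⟧) (⟦⟧-homo-+ n o) ⟩
    (⟦ n ⟧ + ⟦ o ⟧) - ⟦ o ⟧  ≡⟨ solve 2 (λ x y → (x :+ y) :- y := x) refl ⟦ n ⟧ ⟦ o ⟧ ⟩
    ⟦ n ⟧                    ∎
    where
    open ≤-Reasoning
    open +-*-Solver using (solve; _:=_; _:+_; _:-_)

  sieve-bound : ∀ (A B : ℕ → ℕ) (S M : ℕ) ps → All Prime ps →
    sum (map A ps) ℕ.+ sum (map B ps) ℕ.+ S ℕ.≤ M ℕ.+ (length ps ℕ.+ length ps) ℕ.* S →
    Σℚ ps (λ p → (⟦ A p ⟧ - θ p *ℚ ⟦ S ⟧) + (⟦ B p ⟧ - θ p *ℚ ⟦ S ⟧)) + δ₂ ps *ℚ ⟦ S ⟧ ≤ ⟦ M ⟧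
  sieve-bound A B S M ps ps-prime counted = begin
    Σℚ ps (λ p → (⟦ A p ⟧ - θ p *ℚ s) + (⟦ B p ⟧ - θ p *ℚ s)) + δ₂ ps *ℚ s
      ≡⟨ cong (_+ δ₂ ps *ℚ s) (Σℚ-θ-weights (λ p → ⟦ A p ⟧) (λ p → ⟦ B p ⟧) s ps ps-prime) ⟩
    ((ΣA + ΣB) - (N + N) *ℚ s + ⟦ 2 ⟧ *ℚ σ *ℚ s) + (1ℚ - ⟦ 2 ⟧ *ℚ σ) *ℚ s
      ≡⟨ solve 5 (λ A B N σ s → (((A :+ B) :- (N :+ N) :* s) :+ (con ⟦ 2 ⟧ :* σ) :* s) :+ (con 1ℚ :- con ⟦ 2 ⟧ :* σ) :* s
                               := ((A :+ B) :+ s) :- (N :+ N) :* s) refl ΣA ΣB N σ s ⟩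
    ((ΣA + ΣB) + s) - (N + N) *ℚ s
      ≡⟨ cong₂ _-_ ⟦counted⟧ ⟦multiple⟧ ⟨
    ⟦ sum (map A ps) ℕ.+ sum (map B ps) ℕ.+ S ⟧ - ⟦ (length ps ℕ.+ length ps) ℕ.* S ⟧
      ≤⟨ m≤n+o⇒⟦m⟧-⟦o⟧≤⟦n⟧ {n = M} counted ⟩
    ⟦ M ⟧ ∎
    where
    open ≤-Reasoning
    open +-*-Solver using (solve; _:=_; _:+_; _:-_; _:*_; con)
    s = ⟦ S ⟧
    ΣA = Σℚ ps (λ p → ⟦ A p ⟧)
    ΣB = Σℚ ps (λ p → ⟦ B p ⟧)
    N = ⟦ length ps ⟧
    σ = Σℚ ps inv
    ⟦counted⟧ : ⟦ sum (map A ps) ℕ.+ sum (map B ps) ℕ.+ S ⟧ ≡ (ΣA + ΣB) + s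
    ⟦counted⟧ = trans (⟦⟧-homo-+ (sum (map A ps) ℕ.+ sum (map B ps)) S)
      (cong (_+ s) (trans (⟦⟧-homo-+ (sum (map A ps)) (sum (map B ps))) (cong₂ _+_ (⟦⟧-homo-sum A ps) (⟦⟧-homo-sum B ps))))
    ⟦multiple⟧ : ⟦ (length ps ℕ.+ length ps) ℕ.* S ⟧ ≡ (N + N) *ℚ s
    ⟦multiple⟧ = trans (⟦⟧-homo-* (length ps ℕ.+ length ps) S) (cong (_*ℚ s) (⟦⟧-homo-+ (length ps) (length ps)))

module Counting where

  open import Data.Bool using (Bool; true; false; T)
  open import Data.Empty using (⊥-elim)
  open import Data.Nat using (ℕ; _+_; _*_; _≤_; z≤n; s≤s)
  open import Data.Nat.Properties
  open import Algebra.Properties.CommutativeSemigroup +-commutativeSemigroup using (interchange)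
  open import Data.Nat.ListAction using (sum)
  open import Data.Nat.ListAction.Properties using (sum-++)
  open import Data.Nat.Tactic.RingSolver using (solve-∀)
  open import Data.List using (List; []; _∷_; _++_; length; map; filterᵇ)
  open import Data.List.Properties using (map-∘; map-cong; map-++; length-map; length-++)
  open import Data.List.Membership.Propositional using (_∈_)
  open import Data.List.Relation.Unary.All using (All; []; _∷_)
  open import Data.List.Relation.Unary.All.Properties using () renaming (map⁺ to All-map⁺; map⁻ to All-map⁻)
  open import Data.List.Relation.Unary.Any using (here; there)
  open import Data.Sum using (inj₁; inj₂)
  open import Function using (_∘_)
  open import Relation.Nullary using (¬_; contradiction)
  open import Relation.Binary.PropositionalEquality

  𝟙 : Bool → ℕ
  𝟙 true = 1
  𝟙 false = 0

  sum-𝟙≤length : ∀ bs → sum (map 𝟙 bs) ≤ length bs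
  sum-𝟙≤length [] = z≤n
  sum-𝟙≤length (true ∷ bs) = s≤s (sum-𝟙≤length bs)
  sum-𝟙≤length (false ∷ bs) = m≤n⇒m≤1+n (sum-𝟙≤length bs)

  sum-𝟙≡length⇒All : ∀ bs → sum (map 𝟙 bs) ≡ length bs → All T bs
  sum-𝟙≡length⇒All [] _ = []
  sum-𝟙≡length⇒All (true ∷ bs) eq = _ ∷ sum-𝟙≡length⇒All bs (suc-injective eq)
  sum-𝟙≡length⇒All (false ∷ bs) eq = contradiction (sum-𝟙≤length bs) (<⇒≱ (≤-reflexive (sym eq)))

  All¬T⇒sum-𝟙≡0 : ∀ {bs} → All (¬_ ∘ T) bs → sum (map 𝟙 bs) ≡ 0
  All¬T⇒sum-𝟙≡0 [] = refl
  All¬T⇒sum-𝟙≡0 {false ∷ _} (_ ∷ ¬bs) = All¬T⇒sum-𝟙≡0 ¬bs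
  All¬T⇒sum-𝟙≡0 {true ∷ _} (¬b ∷ _) = ⊥-elim (¬b _)

  sieve-pointwise : ∀ bs s m → All (λ b → T b → T s) bs → (T s → All T bs → T m) →
                    sum (map 𝟙 bs) + 𝟙 s ≤ 𝟙 m + length bs * 𝟙 s
  sieve-pointwise bs false m b⇒s _ rewrite All¬T⇒sum-𝟙≡0 b⇒s = z≤n
  sieve-pointwise bs true m _ all⇒m rewrite *-identityʳ (length bs) | +-comm (sum (map 𝟙 bs)) 1
    with m≤n⇒m<n∨m≡n (sum-𝟙≤length bs)
  ... | inj₁ σ<n = ≤-trans σ<n (m≤n+m (length bs) (𝟙 m))
  ... | inj₂ σ≡n with m | all⇒m _ (sum-𝟙≡length⇒All bs σ≡n)
  ...   | true | _ = s≤s (≤-reflexive σ≡n)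

  sum-map-+ : ∀ {A : Set} (f g : A → ℕ) xs → sum (map (λ x → f x + g x) xs) ≡ sum (map f xs) + sum (map g xs)
  sum-map-+ f g [] = refl
  sum-map-+ f g (x ∷ xs) = trans (cong (f x + g x +_) (sum-map-+ f g xs)) (interchange (f x) (g x) _ _)

  sum-map-0 : ∀ {A : Set} (xs : List A) → sum (map (λ _ → 0) xs) ≡ 0
  sum-map-0 [] = refl
  sum-map-0 (_ ∷ xs) = sum-map-0 xs

  sum-map-++-map : ∀ {A B : Set} (g : B → ℕ) (f h : A → B) xs →
                   sum (map g (map f xs ++ map h xs)) ≡ sum (map (g ∘ f) xs) + sum (map (g ∘ h) xs)
  sum-map-++-map g f h xs = begin
    sum (map g (map f xs ++ map h xs))               ≡⟨ cong sum (map-++ g (map f xs) (map h xs)) ⟩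
    sum (map g (map f xs) ++ map g (map h xs))       ≡⟨ sum-++ (map g (map f xs)) (map g (map h xs)) ⟩
    sum (map g (map f xs)) + sum (map g (map h xs))  ≡⟨ cong₂ _+_ (cong sum (map-∘ xs)) (cong sum (map-∘ xs)) ⟨
    sum (map (g ∘ f) xs) + sum (map (g ∘ h) xs)      ∎
    where open ≡-Reasoning

  length-map-++-map : ∀ {A B : Set} (f h : A → B) xs → length (map f xs ++ map h xs) ≡ length xs + length xs
  length-map-++-map f h xs = trans (length-++ (map f xs)) (cong₂ _+_ (length-map f xs) (length-map h xs))

  module _ {X : Set} where

    count : (X → Bool) → List X → ℕ
    count P xs = length (filterᵇ P xs)

    count-∷ : ∀ P x xs → count P (x ∷ xs) ≡ 𝟙 (P x) + count P xs
    count-∷ P x xs with P x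
    ... | true = refl
    ... | false = refl

    distinct∈⇒2≤length : ∀ {x y : X} {xs} → x ≢ y → x ∈ xs → y ∈ xs → 2 ≤ length xs
    distinct∈⇒2≤length x≢y (here refl) (here refl) = contradiction refl x≢y
    distinct∈⇒2≤length _ (here refl) (there {xs = _ ∷ _} _) = s≤s (s≤s z≤n)
    distinct∈⇒2≤length _ (there {xs = _ ∷ _} _) _ = s≤s (s≤s z≤n)

    sieve : ∀ (Ps : List (X → Bool)) (S M : X → Bool) →
            (∀ x → All (λ P → T (P x) → T (S x)) Ps) →
            (∀ x → T (S x) → All (λ P → T (P x)) Ps → T (M x)) →
            ∀ xs → sum (map (λ P → count P xs) Ps) + count S xs ≤ count M xs + length Ps * count S xs
    sieve Ps S M _ _ [] rewrite sum-map-0 Ps | *-zeroʳ (length Ps) = z≤n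
    sieve Ps S M below above (x ∷ xs) = begin
      sum (map (λ P → count P (x ∷ xs)) Ps) + count S (x ∷ xs)
        ≡⟨ cong₂ _+_ (trans (cong sum (map-cong (λ P → count-∷ P x xs) Ps)) (sum-map-+ _ _ Ps)) (count-∷ S x xs) ⟩
      (σ + Σ) + (s + C)
        ≡⟨ interchange σ Σ s C ⟩
      (σ + s) + (Σ + C)
        ≤⟨ +-mono-≤ at-x (sieve Ps S M below above xs) ⟩
      (𝟙 (M x) + n * s) + (count M xs + n * C)
        ≡⟨ distribute (𝟙 (M x)) (count M xs) n s C ⟩
      (𝟙 (M x) + count M xs) + n * (s + C)
        ≡⟨ cong₂ (λ m c → m + n * c) (count-∷ M x xs) (count-∷ S x xs) ⟨
      count M (x ∷ xs) + n * count S (x ∷ xs) ∎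
      where
      open ≤-Reasoning
      n = length Ps
      σ = sum (map (λ P → 𝟙 (P x)) Ps)
      Σ = sum (map (λ P → count P xs) Ps)
      s = 𝟙 (S x)
      C = count S xs
      distribute : ∀ a b k c d → (a + k * c) + (b + k * d) ≡ (a + b) + k * (c + d)
      distribute = solve-∀
      at-x : σ + s ≤ 𝟙 (M x) + n * s
      at-x = subst₂ (λ σ′ n′ → σ′ + s ≤ 𝟙 (M x) + n′ * s) (cong sum (sym (map-∘ Ps))) (length-map (λ P → P x) Ps)
               (sieve-pointwise (map (λ P → P x) Ps) (S x) (M x) (All-map⁺ (below x)) (λ Sx → above x Sx ∘ All-map⁻))

module Decidability where

  open import Data.Bool using (Bool; true; false; T; not)
  open import Data.Bool.ListAction using (any)
  open import Data.List.Relation.Unary.Any using (Any)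
  open import Data.List.Relation.Unary.Any.Properties using (any⇔)
  open import Function using (_∘_; _⇔_; mk⇔; Equivalence)
  open import Relation.Nullary using (¬_; Dec; yes; no; does)

  open Equivalence using (to; from)

  T-does : ∀ {A : Set} (a? : Dec A) → T (does a?) ⇔ A
  T-does (yes a) = mk⇔ (λ _ → a) (λ _ → _)
  T-does (no ¬a) = mk⇔ (λ ()) ¬a

  T-not : ∀ {b} → T (not b) ⇔ (¬ T b)
  T-not {true} = mk⇔ (λ ()) (λ ¬t → ¬t _)
  T-not {false} = mk⇔ (λ _ ()) (λ _ → _)

  T-not-any : ∀ {A : Set} (p : A → Bool) xs → T (not (any p xs)) ⇔ (¬ Any (T ∘ p) xs)
  T-not-any p xs = mk⇔ (λ t → to T-not t ∘ to any⇔) (λ ¬any → from T-not (¬any ∘ from any⇔))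

module Freeness (F : FiniteField) where

  open import Algebra.Structures using (IsCommutativeRing)
  open import Data.Bool using (Bool; T; not; _∧_)
  open import Data.Bool.Properties using (T-∧)
  open import Data.Bool.ListAction using (any)
  open import Data.Nat as ℕ using (ℕ; zero; suc; _*_; _∸_; _≤_; _≟_; s≤s; NonZero)
  import Data.Nat.Properties as ℕ
  open import Data.Nat.Divisibility using (_∣_; _∣?_; divides; ∣⇒≤; ∣-trans; ∣-refl; m∣m*n; n∣m*n)
  open import Data.Nat.Primality using (Prime; euclidsLemma; prime⇒nonZero)
  open import Data.Nat.Primality.Factorisation using (factorisationHasAllPrimeFactors)
  open import Data.Nat.ListAction using (sum; product)
  open import Data.List using (_++_; length; map; upTo)
  open import Data.List.Membership.Propositional using (lose)
  open import Data.List.Membership.Propositional.Properties using (∈-upTo⁺)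
  open import Data.List.Relation.Unary.All as All using (All)
  open import Data.List.Relation.Unary.All.Properties using (++⁺; ++⁻; map⁺; map⁻)
  open import Data.List.Relation.Unary.Any using (satisfied)
  open import Data.List.Relation.Unary.Any.Properties using (any⇔)
  open import Data.Product using (∃-syntax; _×_; _,_; proj₁; proj₂)
  open import Data.Sum using (inj₁; inj₂)
  open import Function using (_∘_; _⇔_; mk⇔; Equivalence; case_of_)
  open import Relation.Nullary using (¬_; does)
  open import Relation.Nullary.Decidable using (¬?; _×-dec_)
  open import Relation.Binary.PropositionalEquality

  open FiniteField F renaming (_+_ to _+ᶠ_; _*_ to _*ᶠ_)
  open IsCommutativeRing isCommutativeRing using (*-assoc; *-identityˡ)
  open Equivalence using (to; from)
  open Decidability
  open Primes

  ^-+ : ∀ b m n → b ^ (m ℕ.+ n) ≡ (b ^ m) *ᶠ (b ^ n)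
  ^-+ b zero n = sym (*-identityˡ _)
  ^-+ b (suc m) n = trans (cong (b *ᶠ_) (^-+ b m n)) (sym (*-assoc b _ _))

  ^-* : ∀ b m n → b ^ (n * m) ≡ (b ^ m) ^ n
  ^-* b m zero = refl
  ^-* b m (suc n) = trans (^-+ b m (n * m)) (cong ((b ^ m) *ᶠ_) (^-* b m n))

  PowerDegree : ℕ → Carrier → ℕ → Set
  PowerDegree e a d = d ≢ 1 × d ∣ e × ∃[ b ] a ≡ b ^ d

  IsFree : ℕ → Carrier → Set
  IsFree e a = a ≢ 0# × (∀ d → ¬ PowerDegree e a d)

  isPowerDegree : ℕ → Carrier → ℕ → Bool
  isPowerDegree e a d = does ((¬? (d ≟ 1)) ×-dec (d ∣? e)) ∧ any (λ b → does (a ≟F (b ^ d))) elems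

  T-isPowerDegree : ∀ e a d → T (isPowerDegree e a d) ⇔ PowerDegree e a d
  T-isPowerDegree e a d = mk⇔ ⇒ ⇐
    where
    ⇒ : T (isPowerDegree e a d) → PowerDegree e a d
    ⇒ t with to T-∧ t
    ... | divisor , power with to (T-does ((¬? (d ≟ 1)) ×-dec (d ∣? e))) divisor | satisfied (from (any⇔ {xs = elems}) power)
    ...   | d≢1 , d∣e | b , a≡bᵈ = d≢1 , d∣e , b , to (T-does (a ≟F (b ^ d))) a≡bᵈ
    ⇐ : PowerDegree e a d → T (isPowerDegree e a d)
    ⇐ (d≢1 , d∣e , b , a≡bᵈ) = from T-∧ (from (T-does ((¬? (d ≟ 1)) ×-dec (d ∣? e))) (d≢1 , d∣e) ,
                                        to (any⇔ {xs = elems}) (lose (elems-complete b) (from (T-does (a ≟F (b ^ d))) a≡bᵈ)))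

  -- isFree only searches the degrees d ≤ e, which covers every divisor of e only when e ≠ 0.
  T-isFree : ∀ e .{{_ : NonZero e}} a → T (isFree e a) ⇔ IsFree e a
  T-isFree e a = mk⇔ ⇒ ⇐
    where
    ⇒ : T (isFree e a) → IsFree e a
    ⇒ t with to T-∧ t
    ... | nonzero , unpowered = to T-not nonzero ∘ from (T-does (a ≟F 0#)) , λ d pd →
      to (T-not-any (isPowerDegree e a) (upTo (suc e))) unpowered
        (lose (∈-upTo⁺ (s≤s (∣⇒≤ (proj₁ (proj₂ pd))))) (from (T-isPowerDegree e a d) pd))
    ⇐ : IsFree e a → T (isFree e a)
    ⇐ (a≢0 , unpowered) = from T-∧ (from T-not (a≢0 ∘ to (T-does (a ≟F 0#))) ,
      from (T-not-any (isPowerDegree e a) (upTo (suc e))) λ t → let d , pd = satisfied t in unpowered d (to (T-isPowerDegree e a d) pd))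

  IsFree-∣ : ∀ {e e′ a} → e ∣ e′ → IsFree e′ a → IsFree e a
  IsFree-∣ e∣e′ (a≢0 , unpowered) = a≢0 , λ d (d≢1 , d∣e , root) → unpowered d (d≢1 , ∣-trans d∣e e∣e′ , root)

  PowerDegree⇒prime : ∀ {e a d} .{{_ : NonZero e}} → PowerDegree e a d → ∃[ r ] Prime r × PowerDegree e a r
  PowerDegree⇒prime {e} {a} {d} (d≢1 , d∣e , b , a≡bᵈ) with ∃-prime-∣ (ℕ.≢-nonZero⁻¹ d {{∣⇒nonZero d∣e}}) d≢1
  ... | r , r-prime , r∣d@(divides c d≡c*r) =
    r , r-prime , prime⇒≢1 r-prime , ∣-trans r∣d d∣e , b ^ c , (begin
      a              ≡⟨ a≡bᵈ ⟩
      b ^ d          ≡⟨ cong (b ^_) (trans d≡c*r (ℕ.*-comm c r)) ⟩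
      b ^ (r * c)    ≡⟨ ^-* b c r ⟩
      (b ^ c) ^ r    ∎)
    where open ≡-Reasoning

  IsFree-radical : ∀ {m k ps a} .{{_ : NonZero m}} → All Prime ps → Rad m ≡ k * product ps →
                   IsFree k a → All (λ p → IsFree (p * k) a) ps → IsFree m a
  IsFree-radical {m} {k} {ps} ps-prime rad≡kΠps (a≢0 , k-unpowered) pk-free = a≢0 , λ d pd →
    let r , r-prime , r≢1 , r∣m , root = PowerDegree⇒prime pd in
    case euclidsLemma k (product ps) r-prime (subst (r ∣_) rad≡kΠps (prime∣⇒∣Rad r-prime r∣m)) of λ where
      (inj₁ r∣k) → k-unpowered r (r≢1 , r∣k , root)
      (inj₂ r∣Πps) → proj₂ (All.lookup pk-free (factorisationHasAllPrimeFactors r-prime r∣Πps ps-prime))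
                       r (r≢1 , m∣m*n k , root)

  q∸1-nonZero : NonZero (q ∸ 1)
  q∸1-nonZero = ℕ.>-nonZero (ℕ.∸-monoˡ-≤ 1 (Counting.distinct∈⇒2≤length 0≢1 (elems-complete 0#) (elems-complete 1#)))

  module _ (u v : Carrier) where

    open Counting using (count; sieve; sum-map-++-map; length-map-++-map)

    -- Mcount u v e₁ e₂ is by definition count (isFreePair e₁ e₂) elems.
    isFreePair : ℕ → ℕ → Carrier → Bool
    isFreePair e₁ e₂ a = not (does (a ≟F 0#)) ∧ isFree e₁ a ∧ isFree e₂ ((u *ᶠ a) +ᶠ (v *ᶠ (a ⁻¹)))

    FreePair : ℕ → ℕ → Carrier → Set
    FreePair e₁ e₂ a = IsFree e₁ a × IsFree e₂ ((u *ᶠ a) +ᶠ (v *ᶠ (a ⁻¹)))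

    T-isFreePair : ∀ e₁ e₂ .{{_ : NonZero e₁}} .{{_ : NonZero e₂}} a → T (isFreePair e₁ e₂ a) ⇔ FreePair e₁ e₂ a
    T-isFreePair e₁ e₂ a = mk⇔ ⇒ ⇐
      where
      ⇒ : T (isFreePair e₁ e₂ a) → FreePair e₁ e₂ a
      ⇒ t with to (T-∧ {not (does (a ≟F 0#))}) t
      ... | _ , free with to (T-∧ {isFree e₁ a}) free
      ...   | free₁ , free₂ = to (T-isFree e₁ a) free₁ , to (T-isFree e₂ _) free₂
      ⇐ : FreePair e₁ e₂ a → T (isFreePair e₁ e₂ a)
      ⇐ (free₁ , free₂) = from T-∧ (from T-not (proj₁ free₁ ∘ to (T-does (a ≟F 0#))) ,
                                    from T-∧ (from (T-isFree e₁ a) free₁ , from (T-isFree e₂ _) free₂))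

    isFreePair-∣ : ∀ {e₁ e₂ e₁′ e₂′} .{{_ : NonZero e₁′}} .{{_ : NonZero e₂′}} a →
                   e₁ ∣ e₁′ → e₂ ∣ e₂′ → T (isFreePair e₁′ e₂′ a) → T (isFreePair e₁ e₂ a)
    isFreePair-∣ {e₁} {e₂} a e₁∣e₁′ e₂∣e₂′ t with to (T-isFreePair _ _ a) t
    ... | free₁ , free₂ = from (T-isFreePair e₁ e₂ {{∣⇒nonZero e₁∣e₁′}} {{∣⇒nonZero e₂∣e₂′}} a)
                               (IsFree-∣ e₁∣e₁′ free₁ , IsFree-∣ e₂∣e₂′ free₂)

    isFreePair-radical : ∀ {m k ps} .{{_ : NonZero m}} .{{k≢0 : NonZero k}} → All Prime ps → Rad m ≡ k * product ps → ∀ a →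
                         T (isFreePair k k a) →
                         All (λ p → T (isFreePair (p * k) k a)) ps → All (λ p → T (isFreePair k (p * k) a)) ps →
                         T (isFreePair m m a)
    isFreePair-radical {m} {k} {{_}} {{k≢0}} ps-prime rad≡kΠps a t A-free B-free with to (T-isFreePair k k a) t
    ... | free₁ , free₂ = from (T-isFreePair m m a)
      ( IsFree-radical ps-prime rad≡kΠps free₁
          (All.zipWith (λ (p-prime , tA) → proj₁ (to (T-isFreePair _ k {{prime*-nonZero p-prime}} a) tA)) (ps-prime , A-free))
      , IsFree-radical ps-prime rad≡kΠps free₂
          (All.zipWith (λ (p-prime , tB) → proj₂ (to (T-isFreePair k _ {{k≢0}} {{prime*-nonZero p-prime}} a) tB)) (ps-prime , B-free)))

    Mcount-sieve : ∀ k ps → k ∣ q ∸ 1 → All Prime ps → Rad (q ∸ 1) ≡ k * product ps →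
      sum (map (λ p → Mcount u v (p * k) k) ps) ℕ.+ sum (map (λ p → Mcount u v k (p * k)) ps) ℕ.+ Mcount u v k k
        ≤ Mcount u v (q ∸ 1) (q ∸ 1) ℕ.+ (length ps ℕ.+ length ps) * Mcount u v k k
    Mcount-sieve k ps k∣m ps-prime rad≡kΠps =
      subst₂ (λ Σ n → Σ ℕ.+ S ≤ Mcount u v m m ℕ.+ n * S)
             (sum-map-++-map (λ P → count P elems) A B ps) (length-map-++-map A B ps)
             (sieve (map A ps ++ map B ps) (isFreePair k k) (isFreePair m m) below above elems)
      where
      m = q ∸ 1
      S = Mcount u v k k
      instance
        m-nonZero : NonZero m
        m-nonZero = q∸1-nonZero
        k-nonZero : NonZero k
        k-nonZero = ∣⇒nonZero k∣m
      A B : ℕ → Carrier → Bool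
      A p = isFreePair (p * k) k
      B p = isFreePair k (p * k)
      below : ∀ a → All (λ P → T (P a) → T (isFreePair k k a)) (map A ps ++ map B ps)
      below a = ++⁺ (map⁺ (All.map (λ {p} p-prime → isFreePair-∣ {k} {k} {p * k} {k} {{prime*-nonZero p-prime}} a (n∣m*n p) ∣-refl) ps-prime))
                    (map⁺ (All.map (λ {p} p-prime → isFreePair-∣ {k} {k} {k} {p * k} {{k-nonZero}} {{prime*-nonZero p-prime}} a ∣-refl (n∣m*n p)) ps-prime))
      above : ∀ a → T (isFreePair k k a) → All (λ P → T (P a)) (map A ps ++ map B ps) → T (isFreePair m m a)
      above a t all-free with ++⁻ (map A ps) all-free
      ... | A-free , B-free = isFreePair-radical {m} {k} ps-prime rad≡kΠps a t (map⁻ A-free) (map⁻ B-free)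

open import Data.Nat using (ℕ; _∸_; _*_)
open import Data.Nat.Divisibility using (_∣_)
open import Data.Nat.Primality using (Prime)
open import Data.List using (List)
open import Data.Nat.ListAction using (product)
open import Data.List.Relation.Unary.All using (All)
open import Data.List.Relation.Unary.Unique.Propositional using (Unique)
open import Data.Rational using (_≤_; _+_; _-_) renaming (_*_ to _*ℚ_)
open import Relation.Binary.PropositionalEquality using (_≡_; _≢_)

lemma6p2 : (F : FiniteField) (u v : FiniteField.Carrier F)
  → u ≢ FiniteField.0# F → v ≢ FiniteField.0# F
  → (k : ℕ) → k ∣ (FiniteField.q F ∸ 1)
  → (ps : List ℕ) → All Prime ps → Unique ps
  → Rad (FiniteField.q F ∸ 1) ≡ k * product ps
  → (Σℚ ps (λ p → (⟦ FiniteField.Mcount F u v (p * k) k ⟧ - (θ p *ℚ ⟦ FiniteField.Mcount F u v k k ⟧))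
                 + (⟦ FiniteField.Mcount F u v k (p * k) ⟧ - (θ p *ℚ ⟦ FiniteField.Mcount F u v k k ⟧))))
    + (δ₂ ps *ℚ ⟦ FiniteField.Mcount F u v k k ⟧)
    ≤ ⟦ FiniteField.Mcount F u v (FiniteField.q F ∸ 1) (FiniteField.q F ∸ 1) ⟧
lemma6p2 F u v _ _ k k∣q-1 ps ps-prime _ rad≡kΠps =
  Rationals.sieve-bound (λ p → Mcount u v (p * k) k) (λ p → Mcount u v k (p * k)) (Mcount u v k k) (Mcount u v (q ∸ 1) (q ∸ 1))
    ps ps-prime (Freeness.Mcount-sieve F u v k ps k∣q-1 ps-prime rad≡kΠps)
  where open FiniteField F using (Mcount; q)
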